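{- Let $\Gamma_1=(u\xrightarrow{p}x\xrightarrow{q}v)$ be a path of length $2$ in $B(\mathfrak S_n)$ and let $\Gamma_2=(u\xrightarrow{s}y\xrightarrow{t}v)$ be the flip of $\Gamma_1$. Then: (1) if $p$ and $q$ commute, then $s=q$ and $t=p$; (2) if $p=(a,b)$ and $q=(a,c)$ (with $a,b,c$ distinct): (i) if $a<b<c$ or $a>b>c$, then $s=(b,c)$ and $t=(a,b)$; (ii) if $a<c<b$ or $a>c>b$, then $s=(a,c)$ and $t=(b,c)$; (iii) if $b<a<c$ or $b>a>c$, then: if $u^{ -1}(b)<u^{ -1}(a)<u^{ -1}(c)$ or $u^{ -1}(c)<u^{ -1}(a)<u^{ -1}(b)$, then $s=(a,c)$ and $t=(b,c)$; otherwise $s=(b,c)$ and $t=(a,b)$.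
   Context: $\mathfrak S_n$ is the symmetric group on $[n]$, $\ell$ its Coxeter length w.r.t. the simple transpositions $(i,i+1)$, $T$ its set of transpositions. The Bruhat graph $B(\mathfrak S_n)$ has vertex set $\mathfrak S_n$ and an edge $u\xrightarrow{t}v$ labelled $t$ whenever $vu^{ -1}=t\in T$ and $\ell(u)<\ell(v)$. For any $u,v$ the set of paths of length 2 from $u$ to $v$ in $B(\mathfrak S_n)$ has 0 or 2 elements; if it has 2, each is called the flip of the other. -}

module Defs where

open import Data.Nat using (ℕ; _+_)
import Data.Nat as ℕ
open import Data.Fin using (Fin; _<_; _<?_)
open import Data.Fin.Permutation public
  using (Permutation′; _⟨$⟩ʳ_; _⟨$⟩ˡ_; transpose; _≈_)
open import Data.List using (List; map; allFin)
open import Data.Nat.ListAction using (sum)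
open import Data.Sum using (_⊎_)
open import Data.Fin using (_>_)
open import Data.Product using (Σ; ∃; ∃-syntax; _×_; _,_)
open import Relation.Binary.PropositionalEquality using (_≡_; _≢_)
open import Relation.Nullary using (yes; no; ¬_)

-- Permutations of [n] (elements of 𝔖_n), as bijections Fin n ↔ Fin n.
-- Equality of permutations is pointwise equality '_≈_' from Data.Fin.Permutation.
Perm : ℕ → Set
Perm n = Permutation′ n

-- Coxeter length = number of inversions: pairs i < j with u(i) > u(j).
inv? : ∀ {n} → Perm n → Fin n → Fin n → ℕ
inv? u i j with i <? j | (u ⟨$⟩ʳ j) <? (u ⟨$⟩ʳ i)
... | yes _ | yes _ = 1
... | _     | _     = 0

ℓ : ∀ {n} → Perm n → ℕ
ℓ {n} u = sum (map (λ i → sum (map (λ j → inv? u i j) (allFin n))) (allFin n))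

IsTransposition : ∀ {n} → Perm n → Set
IsTransposition {n} t = ∃[ a ] ∃[ b ] (a ≢ b × t ≈ transpose a b)

IsLeftProduct : ∀ {n} → Perm n → Perm n → Perm n → Set
IsLeftProduct v t u = ∀ i → v ⟨$⟩ʳ i ≡ t ⟨$⟩ʳ (u ⟨$⟩ʳ i)

BruhatEdge : ∀ {n} → Perm n → Perm n → Perm n → Set
BruhatEdge u t v = IsTransposition t × IsLeftProduct v t u × ℓ u ℕ.< ℓ v

Commute : ∀ {n} → Perm n → Perm n → Set
Commute p q = ∀ i → p ⟨$⟩ʳ (q ⟨$⟩ʳ i) ≡ q ⟨$⟩ʳ (p ⟨$⟩ʳ i)

Between : ∀ {n} → Fin n → Fin n → Fin n → Set
Between x y z = (x < y × y < z) ⊎ (x > y × y > z)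

{-# OPTIONS --safe #-}
module Submission where

-- Both paths end at v, so t s = q p, and s ≠ p since the paths differ. For p = (a b) and ρ = q p,
-- a factorisation ρ = t s into transpositions with s ≠ p has either t = (a b), or s = (a ρb) and
-- t = (ρb b). When p and q commute (hence are disjoint) only the first option survives and forces
-- s = q, t = p. When q = (a c), ρ is the 3-cycle a ↦ b ↦ c ↦ a and both options survive; they are
-- told apart by the edge criterion: w → (e f) w with e < f is an edge only if w⁻¹ e < w⁻¹ f, since
-- otherwise the swap of positions w⁻¹ f < w⁻¹ e would remove inversions. Applied to the four edges,
-- this relates the order of a, b, c to that of their positions u⁻¹ a, u⁻¹ b, u⁻¹ c.

open import Defs
open import Data.Empty using (⊥-elim)
open import Data.Fin using (Fin; zero; suc; _<_; _<?_; _≟_)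
open import Data.Fin.Permutation using (inverseʳ)
import Data.Fin.Permutation.Components as PC
open import Data.Fin.Properties using (<-cmp; <-irrefl; <-asym; <-trans)
open import Data.List using (map; allFin; tabulate)
open import Data.List.Properties using (map-tabulate)
open import Data.Nat as ℕ using (ℕ; _+_; _*_; z≤n) renaming (_≤_ to _≤ℕ_; _<_ to _<ℕ_)
open import Data.Nat.ListAction using (sum)
import Data.Nat.Properties as ℕₚ
open import Data.Nat.Properties
  using (+-comm; *-zeroʳ; +-mono-≤; +-mono-<; ≤-refl; ≤-reflexive; ≤-trans; m≤m+n; <⇒≱; ≮⇒≥; m≤n⇒∃[o]m+o≡n
        ; +-0-commutativeMonoid; module ≤-Reasoning)
open import Data.Nat.Solver using (module +-*-Solver)
open import Data.Product using (_×_; _,_; proj₁; proj₂)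
open import Data.Sum using (_⊎_; inj₁; inj₂; [_,_]′)
open import Function using (_∘_; id)
open import Function.Bundles using (Injection)
open import Function.Properties.Inverse using (↔⇒↣)
open import Relation.Binary using (tri<; tri≈; tri>)
open import Relation.Binary.PropositionalEquality
  using (_≡_; _≢_; refl; sym; trans; cong; cong₂; subst; subst₂; module ≡-Reasoning)
open import Relation.Nullary using (¬_; Dec; yes; no)
open import Relation.Nullary.Decidable using (dec-true; dec-false)

open import Algebra.Properties.CommutativeMonoid.Sum +-0-commutativeMonoid
  using (sum-permute; sum-cong-≗; ∑-distrib-+) renaming (sum to ∑)

transpose-matchˡ : ∀ {n} (i j : Fin n) → PC.transpose i j i ≡ j
transpose-matchˡ i j rewrite dec-true (i ≟ i) refl = refl

transpose-matchʳ : ∀ {n} (i j : Fin n) → PC.transpose i j j ≡ i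
transpose-matchʳ i j with j ≟ i
... | yes j≡i = j≡i
... | no _ rewrite dec-true (j ≟ j) refl = refl

transpose-mismatch : ∀ {n} {i j k : Fin n} → k ≢ i → k ≢ j → PC.transpose i j k ≡ k
transpose-mismatch {i = i} {j} {k} k≢i k≢j
  rewrite dec-false (k ≟ i) k≢i | dec-false (k ≟ j) k≢j = refl

pair-trichotomy : ∀ {n} (i j k : Fin n) → k ≡ i ⊎ k ≡ j ⊎ k ≢ i × k ≢ j
pair-trichotomy i j k with k ≟ i | k ≟ j
... | yes k≡i | _       = inj₁ k≡i
... | no _    | yes k≡j = inj₂ (inj₁ k≡j)
... | no k≢i  | no k≢j  = inj₂ (inj₂ (k≢i , k≢j))

transpose-comm : ∀ {n} (i j k : Fin n) → PC.transpose i j k ≡ PC.transpose j i k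
transpose-comm i j k with pair-trichotomy i j k
... | inj₁ refl               = trans (transpose-matchˡ i j) (sym (transpose-matchʳ j i))
... | inj₂ (inj₁ refl)        = trans (transpose-matchʳ i j) (sym (transpose-matchˡ j i))
... | inj₂ (inj₂ (k≢i , k≢j)) = trans (transpose-mismatch k≢i k≢j) (sym (transpose-mismatch k≢j k≢i))

transpose-conjugate : ∀ {n} (π : Perm n) {i j e f : Fin n} → π ⟨$⟩ʳ i ≡ e → π ⟨$⟩ʳ j ≡ f →
                      ∀ k → PC.transpose e f (π ⟨$⟩ʳ k) ≡ π ⟨$⟩ʳ PC.transpose i j k
transpose-conjugate π {i} {j} {e} {f} πi≡e πj≡f k with pair-trichotomy i j k
... | inj₁ refl = begin
  PC.transpose e f (π ⟨$⟩ʳ i) ≡⟨ cong (PC.transpose e f) πi≡e ⟩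
  PC.transpose e f e          ≡⟨ transpose-matchˡ e f ⟩
  f                           ≡⟨ πj≡f ⟨
  π ⟨$⟩ʳ j                    ≡⟨ cong (π ⟨$⟩ʳ_) (transpose-matchˡ i j) ⟨
  π ⟨$⟩ʳ PC.transpose i j i   ∎
  where open ≡-Reasoning
... | inj₂ (inj₁ refl) = begin
  PC.transpose e f (π ⟨$⟩ʳ j) ≡⟨ cong (PC.transpose e f) πj≡f ⟩
  PC.transpose e f f          ≡⟨ transpose-matchʳ e f ⟩
  e                           ≡⟨ πi≡e ⟨
  π ⟨$⟩ʳ i                    ≡⟨ cong (π ⟨$⟩ʳ_) (transpose-matchʳ i j) ⟨
  π ⟨$⟩ʳ PC.transpose i j j   ∎
  where open ≡-Reasoning
... | inj₂ (inj₂ (k≢i , k≢j)) =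
  trans (transpose-mismatch (λ πk≡e → k≢i (injective (trans πk≡e (sym πi≡e))))
                            (λ πk≡f → k≢j (injective (trans πk≡f (sym πj≡f)))))
        (cong (π ⟨$⟩ʳ_) (sym (transpose-mismatch k≢i k≢j)))
  where open Injection (↔⇒↣ π) using (injective)

m+m≤n+n⇒m≤n : ∀ {m n} → m + m ≤ℕ n + n → m ≤ℕ n
m+m≤n+n⇒m≤n m+m≤n+n = ≮⇒≥ (λ n<m → <⇒≱ (+-mono-< n<m n<m) m+m≤n+n)

sum-tabulate : ∀ {n} (f : Fin n → ℕ) → sum (tabulate f) ≡ ∑ f
sum-tabulate {ℕ.zero}  f = refl
sum-tabulate {ℕ.suc n} f = cong (f zero +_) (sum-tabulate (f ∘ suc))

sum-map-allFin : ∀ {n} (f : Fin n → ℕ) → sum (map f (allFin n)) ≡ ∑ f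
sum-map-allFin f = trans (cong sum (map-tabulate id f)) (sum-tabulate f)

∑-mono-≤ : ∀ {n} {f g : Fin n → ℕ} → (∀ k → f k ≤ℕ g k) → ∑ f ≤ℕ ∑ g
∑-mono-≤ {ℕ.zero}  f≤g = z≤n
∑-mono-≤ {ℕ.suc n} f≤g = +-mono-≤ (f≤g zero) (∑-mono-≤ (f≤g ∘ suc))

∑-mono-≤-except-pair : ∀ {n} (i j : Fin n) {f g : Fin n → ℕ} →
                       (∀ k → k ≢ i → k ≢ j → f k ≤ℕ g k) → f i + f j ≤ℕ g i + g j → ∑ f ≤ℕ ∑ g
∑-mono-≤-except-pair i j {f} {g} off pair = m+m≤n+n⇒m≤n (begin
  ∑ f + ∑ f                 ≡⟨ cong (∑ f +_) (sum-permute f (transpose i j)) ⟩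
  ∑ f + ∑ (f ∘ σ)           ≡⟨ ∑-distrib-+ f (f ∘ σ) ⟨
  ∑ (λ k → f k + f (σ k))   ≤⟨ ∑-mono-≤ orbit ⟩
  ∑ (λ k → g k + g (σ k))   ≡⟨ ∑-distrib-+ g (g ∘ σ) ⟩
  ∑ g + ∑ (g ∘ σ)           ≡⟨ cong (∑ g +_) (sum-permute g (transpose i j)) ⟨
  ∑ g + ∑ g                 ∎)
  where
  open ≤-Reasoning
  σ : Fin _ → Fin _
  σ = PC.transpose i j
  orbit : ∀ k → f k + f (σ k) ≤ℕ g k + g (σ k)
  orbit k with pair-trichotomy i j k
  ... | inj₁ refl        rewrite transpose-matchˡ i j = pair
  ... | inj₂ (inj₁ refl) rewrite transpose-matchʳ i j = subst₂ _≤ℕ_ (+-comm (f i) (f j)) (+-comm (g i) (g j)) pair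
  ... | inj₂ (inj₂ (k≢i , k≢j)) rewrite transpose-mismatch k≢i k≢j = +-mono-≤ (off k k≢i k≢j) (off k k≢i k≢j)

-- Inversions

rearrangement-≤ : ∀ {a₁ a₂ b₁ b₂} → a₁ ≤ℕ a₂ → b₁ ≤ℕ b₂ → a₁ * b₂ + a₂ * b₁ ≤ℕ a₁ * b₁ + a₂ * b₂
rearrangement-≤ {a₁} {_} {b₁} a₁≤a₂ b₁≤b₂ with m≤n⇒∃[o]m+o≡n a₁≤a₂ | m≤n⇒∃[o]m+o≡n b₁≤b₂
... | d , refl | e , refl =
  subst (a₁ * (b₁ + e) + (a₁ + d) * b₁ ≤ℕ_) (excess a₁ b₁ d e) (m≤m+n (a₁ * (b₁ + e) + (a₁ + d) * b₁) (d * e))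
  where
  open +-*-Solver
  excess : ∀ a b d e → a * (b + e) + (a + d) * b + d * e ≡ a * b + (a + d) * (b + e)
  excess = solve 4 (λ a b d e → a :* (b :+ e) :+ (a :+ d) :* b :+ d :* e
                              := a :* b :+ (a :+ d) :* (b :+ e)) refl

⟦_⟧ : ∀ {p} {P : Set p} → Dec P → ℕ
⟦ yes _ ⟧ = 1
⟦ no _ ⟧  = 0

⟦⟧-mono : ∀ {p q} {P : Set p} {Q : Set q} {P? : Dec P} {Q? : Dec Q} → (P → Q) → ⟦ P? ⟧ ≤ℕ ⟦ Q? ⟧
⟦⟧-mono {P? = yes _}  {yes _} P→Q = ≤-refl
⟦⟧-mono {P? = yes pf} {no ¬Q} P→Q = ⊥-elim (¬Q (P→Q pf))
⟦⟧-mono {P? = no _}           P→Q = z≤n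

⟦⟧-¬ : ∀ {p} {P : Set p} (P? : Dec P) → ¬ P → ⟦ P? ⟧ ≡ 0
⟦⟧-¬ (yes pf) ¬P = ⊥-elim (¬P pf)
⟦⟧-¬ (no _)   ¬P = refl

-- Opaque so that unification sees inversion k l a b instead of the unfolded decision procedures.
opaque
  inversion : ∀ {n} → Fin n → Fin n → Fin n → Fin n → ℕ
  inversion k l a b = ⟦ k <? l ⟧ * ⟦ b <? a ⟧

inversions : ∀ {n} → (Fin n → Fin n) → ℕ
inversions f = ∑ λ k → ∑ λ l → inversion k l (f k) (f l)

opaque
  unfolding inversion

  inversion-¬<ˡ : ∀ {n} {k l a b : Fin n} → ¬ k < l → inversion k l a b ≡ 0
  inversion-¬<ˡ {k = k} {l} k≮l = cong (_* _) (⟦⟧-¬ (k <? l) k≮l)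

  inversion-¬<ʳ : ∀ {n} {k l a b : Fin n} → ¬ b < a → inversion k l a b ≡ 0
  inversion-¬<ʳ {k = k} {l} {a} {b} b≮a = trans (cong (⟦ k <? l ⟧ *_) (⟦⟧-¬ (b <? a) b≮a)) (*-zeroʳ ⟦ k <? l ⟧)

  inversion-rearrangement : ∀ {n} {k₁ l₁ k₂ l₂ x₁ y₁ x₂ y₂ : Fin n} →
                            (k₁ < l₁ → k₂ < l₂) → (y₁ < x₁ → y₂ < x₂) →
                            inversion k₁ l₁ x₂ y₂ + inversion k₂ l₂ x₁ y₁ ≤ℕ
                            inversion k₁ l₁ x₁ y₁ + inversion k₂ l₂ x₂ y₂
  inversion-rearrangement {k₁ = k₁} {l₁} {k₂} {l₂} {x₁} {y₁} {x₂} {y₂} k₁<l₁⇒k₂<l₂ y₁<x₁⇒y₂<x₂ =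
    rearrangement-≤ (⟦⟧-mono {P? = k₁ <? l₁} {k₂ <? l₂} k₁<l₁⇒k₂<l₂) (⟦⟧-mono {P? = y₁ <? x₁} {y₂ <? x₂} y₁<x₁⇒y₂<x₂)

  ℓ≡inversions : ∀ {n} (u : Perm n) → ℓ u ≡ inversions (u ⟨$⟩ʳ_)
  ℓ≡inversions {n} u = trans (sum-map-allFin (λ k → sum (map (inv? u k) (allFin n))))
                             (sum-cong-≗ λ k → trans (sum-map-allFin (inv? u k)) (sum-cong-≗ (inv?≡inversion k)))
    where
    inv?≡inversion : ∀ k l → inv? u k l ≡ inversion k l (u ⟨$⟩ʳ k) (u ⟨$⟩ʳ l)
    inv?≡inversion k l with k <? l | u ⟨$⟩ʳ l <? u ⟨$⟩ʳ k
    ... | yes _ | yes _ = refl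
    ... | yes _ | no _  = refl
    ... | no _  | _     = refl

inversions-cong : ∀ {n} {f g : Fin n → Fin n} → (∀ k → f k ≡ g k) → inversions f ≡ inversions g
inversions-cong f≗g = sum-cong-≗ λ k → sum-cong-≗ λ l → cong₂ (inversion k l) (f≗g k) (f≗g l)

-- The swap only exchanges entries of the inversion table in pairs (rows i, j; columns i, j); each pair
-- loses inversions by the rearrangement inequality, and the {i, j} × {i, j} block of f ∘ (i j) is empty.
inversions-swap-≤ : ∀ {n} {f : Fin n → Fin n} {i j : Fin n} → i < j → f j < f i →
                    inversions (f ∘ PC.transpose i j) ≤ℕ inversions f
inversions-swap-≤ {n} {f} {i} {j} i<j fj<fi = ∑-mono-≤-except-pair i j other-row row-pair
  where
  open ≤-Reasoning
  σ : Fin n → Fin n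
  σ = PC.transpose i j
  g : Fin n → Fin n
  g = f ∘ σ
  row : (Fin n → Fin n) → Fin n → Fin n → ℕ
  row h k l = inversion k l (h k) (h l)

  other-row : ∀ k → k ≢ i → k ≢ j → ∑ (row g k) ≤ℕ ∑ (row f k)
  other-row k k≢i k≢j = ∑-mono-≤-except-pair i j unchanged crossing
    where
    gk≡fk : g k ≡ f k
    gk≡fk = cong f (transpose-mismatch k≢i k≢j)
    unchanged : ∀ l → l ≢ i → l ≢ j → row g k l ≤ℕ row f k l
    unchanged l l≢i l≢j = ≤-reflexive (cong₂ (inversion k l) gk≡fk (cong f (transpose-mismatch l≢i l≢j)))
    crossing : row g k i + row g k j ≤ℕ row f k i + row f k j
    crossing = begin
      row g k i + row g k j
        ≡⟨ cong₂ _+_ (cong₂ (inversion k i) gk≡fk (cong f (transpose-matchˡ i j)))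
                     (cong₂ (inversion k j) gk≡fk (cong f (transpose-matchʳ i j))) ⟩
      inversion k i (f k) (f j) + inversion k j (f k) (f i)
        ≤⟨ inversion-rearrangement (λ k<i → <-trans k<i i<j) (<-trans fj<fi) ⟩
      row f k i + row f k j ∎

  row-pair : ∑ (row g i) + ∑ (row g j) ≤ℕ ∑ (row f i) + ∑ (row f j)
  row-pair = begin
    ∑ (row g i) + ∑ (row g j)         ≡⟨ ∑-distrib-+ (row g i) (row g j) ⟨
    ∑ (λ l → row g i l + row g j l)   ≤⟨ ∑-mono-≤-except-pair i j crossing vanishing ⟩
    ∑ (λ l → row f i l + row f j l)   ≡⟨ ∑-distrib-+ (row f i) (row f j) ⟩
    ∑ (row f i) + ∑ (row f j)         ∎
    where
    crossing : ∀ l → l ≢ i → l ≢ j → row g i l + row g j l ≤ℕ row f i l + row f j l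
    crossing l l≢i l≢j = begin
      row g i l + row g j l
        ≡⟨ cong₂ _+_ (cong₂ (inversion i l) (cong f (transpose-matchˡ i j)) gl≡fl)
                     (cong₂ (inversion j l) (cong f (transpose-matchʳ i j)) gl≡fl) ⟩
      inversion i l (f j) (f l) + inversion j l (f i) (f l)
        ≡⟨ +-comm (inversion i l (f j) (f l)) _ ⟩
      inversion j l (f i) (f l) + inversion i l (f j) (f l)
        ≤⟨ inversion-rearrangement (<-trans i<j) (λ fl<fj → <-trans fl<fj fj<fi) ⟩
      inversion j l (f j) (f l) + inversion i l (f i) (f l)
        ≡⟨ +-comm (inversion j l (f j) (f l)) _ ⟩
      row f i l + row f j l ∎
      where
      gl≡fl : g l ≡ f l
      gl≡fl = cong f (transpose-mismatch l≢i l≢j)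
    vanishing : row g i i + row g j i + (row g i j + row g j j) ≤ℕ row f i i + row f j i + (row f i j + row f j j)
    vanishing = ≤-trans (≤-reflexive (cong₂ _+_ (cong₂ _+_ gii≡0 gji≡0) (cong₂ _+_ gij≡0 gjj≡0))) z≤n
      where
      gii≡0 : row g i i ≡ 0
      gii≡0 = inversion-¬<ˡ (<-irrefl refl)
      gji≡0 : row g j i ≡ 0
      gji≡0 = inversion-¬<ˡ (<-asym i<j)
      gjj≡0 : row g j j ≡ 0
      gjj≡0 = inversion-¬<ˡ (<-irrefl refl)
      gij≡0 : row g i j ≡ 0
      gij≡0 = trans (cong₂ (inversion i j) (cong f (transpose-matchˡ i j)) (cong f (transpose-matchʳ i j)))
                    (inversion-¬<ʳ (<-asym fj<fi))

module _ {n} (r : Perm n) {a b : Fin n} (r≈ab : r ≈ transpose a b) where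

  ≈transpose-matchˡ : r ⟨$⟩ʳ a ≡ b
  ≈transpose-matchˡ = trans (r≈ab a) (transpose-matchˡ a b)

  ≈transpose-matchʳ : r ⟨$⟩ʳ b ≡ a
  ≈transpose-matchʳ = trans (r≈ab b) (transpose-matchʳ a b)

  ≈transpose-mismatch : ∀ {k} → k ≢ a → k ≢ b → r ⟨$⟩ʳ k ≡ k
  ≈transpose-mismatch k≢a k≢b = trans (r≈ab _) (transpose-mismatch k≢a k≢b)

  ≈transpose-sym : r ≈ transpose b a
  ≈transpose-sym m = trans (r≈ab m) (transpose-comm a b m)

transposition-involutive : ∀ {n} (r : Perm n) → IsTransposition r → ∀ m → r ⟨$⟩ʳ (r ⟨$⟩ʳ m) ≡ m
transposition-involutive r (a , b , _ , r≈ab) m =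
  trans (r≈ab (r ⟨$⟩ʳ m)) (trans (cong (PC.transpose a b) (≈transpose-sym r r≈ab m)) (PC.transpose-inverse a b))

transposition-≈transpose : ∀ {n} (r : Perm n) {a b : Fin n} → IsTransposition r →
                           r ⟨$⟩ʳ a ≡ b → a ≢ b → r ≈ transpose a b
transposition-≈transpose r {a} {b} (c , d , _ , r≈cd) ra≡b a≢b with pair-trichotomy c d a
... | inj₁ refl = subst (λ z → r ≈ transpose a z) (trans (sym (≈transpose-matchˡ r r≈cd)) ra≡b) r≈cd
... | inj₂ (inj₁ refl) = subst (λ z → r ≈ transpose a z) (trans (sym (≈transpose-matchʳ r r≈cd)) ra≡b) (≈transpose-sym r r≈cd)
... | inj₂ (inj₂ (a≢c , a≢d)) = ⊥-elim (a≢b (trans (sym (≈transpose-mismatch r r≈cd a≢c a≢d)) ra≡b))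

SameOrder : ∀ {n} → Fin n → Fin n → Fin n → Fin n → Set
SameOrder i j e f = (e < f → i < j) × (f < e → j < i)

-- If j < i, then z = w ∘ (j i) swaps an inversion of w, so ℓ z ≤ ℓ w.
bruhatEdge-order : ∀ {n} {w r z : Perm n} {e f i j : Fin n} → BruhatEdge w r z → r ≈ transpose e f →
                   w ⟨$⟩ʳ i ≡ e → w ⟨$⟩ʳ j ≡ f → e < f → i < j
bruhatEdge-order {w = w} {r} {z} {e} {f} {i} {j} (_ , z≡rw , ℓw<ℓz) r≈ef wi≡e wj≡f e<f with <-cmp i j
... | tri< i<j _ _ = i<j
... | tri≈ _ refl _ = ⊥-elim (<-irrefl (trans (sym wi≡e) wj≡f) e<f)
... | tri> _ _ j<i = ⊥-elim (<⇒≱ ℓw<ℓz ℓz≤ℓw)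
  where
  open ≤-Reasoning
  z≗w∘σ : ∀ k → z ⟨$⟩ʳ k ≡ w ⟨$⟩ʳ PC.transpose j i k
  z≗w∘σ k = trans (z≡rw k) (trans (≈transpose-sym r r≈ef (w ⟨$⟩ʳ k)) (transpose-conjugate w wj≡f wi≡e k))
  ℓz≤ℓw : ℓ z ≤ℕ ℓ w
  ℓz≤ℓw = begin
    ℓ z                                      ≡⟨ ℓ≡inversions z ⟩
    inversions (z ⟨$⟩ʳ_)                     ≡⟨ inversions-cong z≗w∘σ ⟩
    inversions ((w ⟨$⟩ʳ_) ∘ PC.transpose j i) ≤⟨ inversions-swap-≤ j<i (subst₂ _<_ (sym wi≡e) (sym wj≡f) e<f) ⟩
    inversions (w ⟨$⟩ʳ_)                     ≡⟨ ℓ≡inversions w ⟨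
    ℓ w                                      ∎

bruhatEdge-sameOrder : ∀ {n} {w r z : Perm n} {e f i j : Fin n} → BruhatEdge w r z → r ≈ transpose e f →
                       w ⟨$⟩ʳ i ≡ e → w ⟨$⟩ʳ j ≡ f → SameOrder i j e f
bruhatEdge-sameOrder {w = w} {r} {z} edge r≈ef wi≡e wj≡f =
  bruhatEdge-order {w = w} {r} {z} edge r≈ef wi≡e wj≡f ,
  bruhatEdge-order {w = w} {r} {z} edge (≈transpose-sym r r≈ef) wj≡f wi≡e

-- Factorisations of a product of two transpositions

-- Write s = (a e) when s moves a; then t sends e to ρ a = b, and s fixes b, so ρ b = t b = e.
transposition-factorisation :
  ∀ {n} (s t : Perm n) {ρ : Fin n → Fin n} {a b : Fin n} →
  IsTransposition s → IsTransposition t → (∀ m → t ⟨$⟩ʳ (s ⟨$⟩ʳ m) ≡ ρ m) →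
  a ≢ b → ρ a ≡ b → ¬ s ≈ transpose a b →
  t ≈ transpose a b ⊎ (ρ b ≢ a × s ≈ transpose a (ρ b) × t ≈ transpose (ρ b) b)
transposition-factorisation s t {ρ} {a} {b} s-trans t-trans ts≗ρ a≢b ρa≡b s≉ab with s ⟨$⟩ʳ a ≟ a
... | yes sa≡a = inj₁ (transposition-≈transpose t t-trans (trans (cong (t ⟨$⟩ʳ_) (sym sa≡a)) (trans (ts≗ρ a) ρa≡b)) a≢b)
... | no sa≢a = inj₂ (subst (_≢ a) (sym ρb≡e) sa≢a , subst (λ z → s ≈ transpose a z) (sym ρb≡e) s≈ae
                                                   , subst (λ z → t ≈ transpose z b) (sym ρb≡e) t≈eb)
  where
  e : Fin _
  e = s ⟨$⟩ʳ a
  s≈ae : s ≈ transpose a e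
  s≈ae = transposition-≈transpose s s-trans refl (sa≢a ∘ sym)
  e≢b : e ≢ b
  e≢b e≡b = s≉ab (subst (λ z → s ≈ transpose a z) e≡b s≈ae)
  t≈eb : t ≈ transpose e b
  t≈eb = transposition-≈transpose t t-trans (trans (ts≗ρ a) ρa≡b) e≢b
  ρb≡e : ρ b ≡ e
  ρb≡e = begin
    ρ b                    ≡⟨ ts≗ρ b ⟨
    t ⟨$⟩ʳ (s ⟨$⟩ʳ b)       ≡⟨ cong (t ⟨$⟩ʳ_) (≈transpose-mismatch s s≈ae (a≢b ∘ sym) (e≢b ∘ sym)) ⟩
    t ⟨$⟩ʳ b               ≡⟨ ≈transpose-matchʳ t t≈eb ⟩
    e                      ∎
    where open ≡-Reasoning

-- If q a = a′ ∉ {a, b}, then q fixes b and p fixes a′, so p q a = a′ while q p a = b.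
commuting-transposition-fixes : ∀ {n} (p q : Perm n) {a b : Fin n} → p ≈ transpose a b → a ≢ b →
                                IsTransposition q → ¬ p ≈ q → Commute p q → q ⟨$⟩ʳ a ≡ a
commuting-transposition-fixes p q {a} {b} p≈ab a≢b q-trans p≉q pq≡qp with q ⟨$⟩ʳ a ≟ a
... | yes qa≡a = qa≡a
... | no qa≢a with q ⟨$⟩ʳ a ≟ b
...   | yes qa≡b = ⊥-elim (p≉q λ m → trans (p≈ab m) (sym (transposition-≈transpose q q-trans qa≡b a≢b m)))
...   | no qa≢b = ⊥-elim (qa≢b (begin
  q ⟨$⟩ʳ a                ≡⟨ ≈transpose-mismatch p p≈ab qa≢a qa≢b ⟨
  p ⟨$⟩ʳ (q ⟨$⟩ʳ a)       ≡⟨ pq≡qp a ⟩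
  q ⟨$⟩ʳ (p ⟨$⟩ʳ a)       ≡⟨ cong (q ⟨$⟩ʳ_) (≈transpose-matchˡ p p≈ab) ⟩
  q ⟨$⟩ʳ b                ≡⟨ ≈transpose-mismatch q q≈a-qa (a≢b ∘ sym) (qa≢b ∘ sym) ⟩
  b                       ∎))
  where
  open ≡-Reasoning
  q≈a-qa : q ≈ transpose a (q ⟨$⟩ʳ a)
  q≈a-qa = transposition-≈transpose q q-trans refl (qa≢a ∘ sym)

module Flip {n} (u x y v p q s t : Perm n)
            (ux : BruhatEdge u p x) (xv : BruhatEdge x q v) (uy : BruhatEdge u s y) (yv : BruhatEdge y t v)
            (not-same : ¬ (s ≈ p × y ≈ x × t ≈ q)) where

  open ≡-Reasoning

  p-trans : IsTransposition p
  p-trans = proj₁ ux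
  q-trans : IsTransposition q
  q-trans = proj₁ xv
  s-trans : IsTransposition s
  s-trans = proj₁ uy
  t-trans : IsTransposition t
  t-trans = proj₁ yv

  x≡pu : IsLeftProduct x p u
  x≡pu = proj₁ (proj₂ ux)
  v≡qx : IsLeftProduct v q x
  v≡qx = proj₁ (proj₂ xv)
  y≡su : IsLeftProduct y s u
  y≡su = proj₁ (proj₂ uy)
  v≡ty : IsLeftProduct v t y
  v≡ty = proj₁ (proj₂ yv)

  ts≗qp : ∀ m → t ⟨$⟩ʳ (s ⟨$⟩ʳ m) ≡ q ⟨$⟩ʳ (p ⟨$⟩ʳ m)
  ts≗qp m = begin
    t ⟨$⟩ʳ (s ⟨$⟩ʳ m)                ≡⟨ cong (λ z → t ⟨$⟩ʳ (s ⟨$⟩ʳ z)) (inverseʳ u) ⟨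
    t ⟨$⟩ʳ (s ⟨$⟩ʳ (u ⟨$⟩ʳ k))       ≡⟨ cong (t ⟨$⟩ʳ_) (y≡su k) ⟨
    t ⟨$⟩ʳ (y ⟨$⟩ʳ k)                ≡⟨ v≡ty k ⟨
    v ⟨$⟩ʳ k                         ≡⟨ v≡qx k ⟩
    q ⟨$⟩ʳ (x ⟨$⟩ʳ k)                ≡⟨ cong (q ⟨$⟩ʳ_) (x≡pu k) ⟩
    q ⟨$⟩ʳ (p ⟨$⟩ʳ (u ⟨$⟩ʳ k))       ≡⟨ cong (λ z → q ⟨$⟩ʳ (p ⟨$⟩ʳ z)) (inverseʳ u) ⟩
    q ⟨$⟩ʳ (p ⟨$⟩ʳ m)                ∎
    where k = u ⟨$⟩ˡ m

  s≗tqp : ∀ m → s ⟨$⟩ʳ m ≡ t ⟨$⟩ʳ (q ⟨$⟩ʳ (p ⟨$⟩ʳ m))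
  s≗tqp m = trans (sym (transposition-involutive t t-trans (s ⟨$⟩ʳ m))) (cong (t ⟨$⟩ʳ_) (ts≗qp m))

  s≉p : ¬ s ≈ p
  s≉p s≈p = not-same (s≈p , y≈x , t≈q)
    where
    y≈x : y ≈ x
    y≈x k = trans (y≡su k) (trans (s≈p (u ⟨$⟩ʳ k)) (sym (x≡pu k)))
    t≈q : t ≈ q
    t≈q m = begin
      t ⟨$⟩ʳ m                         ≡⟨ cong (t ⟨$⟩ʳ_) (transposition-involutive s s-trans m) ⟨
      t ⟨$⟩ʳ (s ⟨$⟩ʳ (s ⟨$⟩ʳ m))       ≡⟨ ts≗qp (s ⟨$⟩ʳ m) ⟩
      q ⟨$⟩ʳ (p ⟨$⟩ʳ (s ⟨$⟩ʳ m))       ≡⟨ cong (λ z → q ⟨$⟩ʳ (p ⟨$⟩ʳ z)) (s≈p m) ⟩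
      q ⟨$⟩ʳ (p ⟨$⟩ʳ (p ⟨$⟩ʳ m))       ≡⟨ cong (q ⟨$⟩ʳ_) (transposition-involutive p p-trans m) ⟩
      q ⟨$⟩ʳ m                         ∎

  s≉ab : ∀ {a b} → p ≈ transpose a b → ¬ s ≈ transpose a b
  s≉ab p≈ab s≈ab = s≉p λ m → trans (s≈ab m) (sym (p≈ab m))

  -- p = q would give v = u, against ℓ u < ℓ x < ℓ v.
  p≉q : ¬ p ≈ q
  p≉q p≈q = ℕₚ.<-asym (proj₂ (proj₂ ux)) (subst (ℓ x <ℕ_) ℓv≡ℓu (proj₂ (proj₂ xv)))
    where
    v≗u : ∀ k → v ⟨$⟩ʳ k ≡ u ⟨$⟩ʳ k
    v≗u k = begin
      v ⟨$⟩ʳ k                         ≡⟨ v≡qx k ⟩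
      q ⟨$⟩ʳ (x ⟨$⟩ʳ k)                ≡⟨ cong (q ⟨$⟩ʳ_) (x≡pu k) ⟩
      q ⟨$⟩ʳ (p ⟨$⟩ʳ (u ⟨$⟩ʳ k))       ≡⟨ p≈q _ ⟨
      p ⟨$⟩ʳ (p ⟨$⟩ʳ (u ⟨$⟩ʳ k))       ≡⟨ transposition-involutive p p-trans (u ⟨$⟩ʳ k) ⟩
      u ⟨$⟩ʳ k                         ∎
    ℓv≡ℓu : ℓ v ≡ ℓ u
    ℓv≡ℓu = trans (ℓ≡inversions v) (trans (inversions-cong v≗u) (sym (ℓ≡inversions u)))

  flip-commuting : Commute p q → s ≈ q × t ≈ p
  flip-commuting pq≡qp = commuting p-trans
    where
    commuting : IsTransposition p → s ≈ q × t ≈ p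
    commuting (a , b , a≢b , p≈ab) =
      [ (λ t≈ab → s≈q t≈ab , t≈p t≈ab) , (λ moved → ⊥-elim (proj₁ moved qpb≡a)) ]′
        (transposition-factorisation s t s-trans t-trans ts≗qp a≢b qpa≡b (s≉ab p≈ab))
      where
      qa≡a : q ⟨$⟩ʳ a ≡ a
      qa≡a = commuting-transposition-fixes p q p≈ab a≢b q-trans p≉q pq≡qp
      qb≡b : q ⟨$⟩ʳ b ≡ b
      qb≡b = commuting-transposition-fixes p q (≈transpose-sym p p≈ab) (a≢b ∘ sym) q-trans p≉q pq≡qp
      qpa≡b : q ⟨$⟩ʳ (p ⟨$⟩ʳ a) ≡ b
      qpa≡b = trans (cong (q ⟨$⟩ʳ_) (≈transpose-matchˡ p p≈ab)) qb≡b
      qpb≡a : q ⟨$⟩ʳ (p ⟨$⟩ʳ b) ≡ a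
      qpb≡a = trans (cong (q ⟨$⟩ʳ_) (≈transpose-matchʳ p p≈ab)) qa≡a
      t≈p : t ≈ transpose a b → t ≈ p
      t≈p t≈ab m = trans (t≈ab m) (sym (p≈ab m))
      s≈q : t ≈ transpose a b → s ≈ q
      s≈q t≈ab m = begin
        s ⟨$⟩ʳ m                                  ≡⟨ s≗tqp m ⟩
        t ⟨$⟩ʳ (q ⟨$⟩ʳ (p ⟨$⟩ʳ m))                ≡⟨ t≈p t≈ab _ ⟩
        p ⟨$⟩ʳ (q ⟨$⟩ʳ (p ⟨$⟩ʳ m))                ≡⟨ pq≡qp (p ⟨$⟩ʳ m) ⟩
        q ⟨$⟩ʳ (p ⟨$⟩ʳ (p ⟨$⟩ʳ m))                ≡⟨ cong (q ⟨$⟩ʳ_) (transposition-involutive p p-trans m) ⟩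
        q ⟨$⟩ʳ m                                  ∎

  module ThreeCycle (a b c : Fin n) (a≢b : a ≢ b) (a≢c : a ≢ c) (b≢c : b ≢ c)
                    (p≈ab : p ≈ transpose a b) (q≈ac : q ≈ transpose a c) where

    First Second : Set
    First  = s ≈ transpose b c × t ≈ transpose a b
    Second = s ≈ transpose a c × t ≈ transpose b c

    qpa≡b : q ⟨$⟩ʳ (p ⟨$⟩ʳ a) ≡ b
    qpa≡b = trans (cong (q ⟨$⟩ʳ_) (≈transpose-matchˡ p p≈ab)) (≈transpose-mismatch q q≈ac (a≢b ∘ sym) b≢c)
    qpb≡c : q ⟨$⟩ʳ (p ⟨$⟩ʳ b) ≡ c
    qpb≡c = trans (cong (q ⟨$⟩ʳ_) (≈transpose-matchʳ p p≈ab)) (≈transpose-matchˡ q q≈ac)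

    candidates : First ⊎ Second
    candidates =
      [ (λ t≈ab → inj₁ (transposition-≈transpose s s-trans (sb≡c t≈ab) b≢c , t≈ab))
      , (λ (_ , s≈a-qpb , t≈qpb-b) → inj₂ ( subst (λ z → s ≈ transpose a z) qpb≡c s≈a-qpb
                                           , ≈transpose-sym t (subst (λ z → t ≈ transpose z b) qpb≡c t≈qpb-b)))
      ]′ (transposition-factorisation s t s-trans t-trans ts≗qp a≢b qpa≡b (s≉ab p≈ab))
      where
      sb≡c : t ≈ transpose a b → s ⟨$⟩ʳ b ≡ c
      sb≡c t≈ab = begin
        s ⟨$⟩ʳ b                       ≡⟨ s≗tqp b ⟩
        t ⟨$⟩ʳ (q ⟨$⟩ʳ (p ⟨$⟩ʳ b))     ≡⟨ cong (t ⟨$⟩ʳ_) qpb≡c ⟩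
        t ⟨$⟩ʳ c                       ≡⟨ ≈transpose-mismatch t t≈ab (a≢c ∘ sym) (b≢c ∘ sym) ⟩
        c                              ∎

    first-unless : ¬ Second → First
    first-unless ¬second = [ id , ⊥-elim ∘ ¬second ]′ candidates

    second-unless : ¬ First → Second
    second-unless ¬first = [ ⊥-elim ∘ ¬first , id ]′ candidates

    A B C : Fin n
    A = u ⟨$⟩ˡ a
    B = u ⟨$⟩ˡ b
    C = u ⟨$⟩ˡ c

    x-at : ∀ {e e′} → p ⟨$⟩ʳ e ≡ e′ → x ⟨$⟩ʳ (u ⟨$⟩ˡ e) ≡ e′
    x-at pe≡e′ = trans (x≡pu _) (trans (cong (p ⟨$⟩ʳ_) (inverseʳ u)) pe≡e′)

    y-at : ∀ {e e′} → s ⟨$⟩ʳ e ≡ e′ → y ⟨$⟩ʳ (u ⟨$⟩ˡ e) ≡ e′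
    y-at se≡e′ = trans (y≡su _) (trans (cong (s ⟨$⟩ʳ_) (inverseʳ u)) se≡e′)

    p-order : SameOrder A B a b
    p-order = bruhatEdge-sameOrder {w = u} {p} {x} ux p≈ab (inverseʳ u) (inverseʳ u)

    q-order : SameOrder B C a c
    q-order = bruhatEdge-sameOrder {w = x} {q} {v} xv q≈ac (x-at (≈transpose-matchʳ p p≈ab))
                                                          (x-at (≈transpose-mismatch p p≈ab (a≢c ∘ sym) (b≢c ∘ sym)))

    first-orders : First → SameOrder B C b c × SameOrder A C a b
    first-orders (s≈bc , t≈ab) =
      bruhatEdge-sameOrder {w = u} {s} {y} uy s≈bc (inverseʳ u) (inverseʳ u) ,
      bruhatEdge-sameOrder {w = y} {t} {v} yv t≈ab (y-at (≈transpose-mismatch s s≈bc a≢b a≢c))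
                                                  (y-at (≈transpose-matchʳ s s≈bc))

    second-orders : Second → SameOrder A C a c × SameOrder B A b c
    second-orders (s≈ac , t≈bc) =
      bruhatEdge-sameOrder {w = u} {s} {y} uy s≈ac (inverseʳ u) (inverseʳ u) ,
      bruhatEdge-sameOrder {w = y} {t} {v} yv t≈bc (y-at (≈transpose-mismatch s s≈ac (a≢b ∘ sym) b≢c))
                                                  (y-at (≈transpose-matchˡ s s≈ac))

    second⇒¬abc : Second → ¬ Between a b c
    second⇒¬abc second with second-orders second
    ... | _ , BA-bc = λ where
      (inj₁ (a<b , b<c)) → <-asym (proj₁ p-order a<b) (proj₁ BA-bc b<c)
      (inj₂ (b<a , c<b)) → <-asym (proj₂ p-order b<a) (proj₂ BA-bc c<b)

    first⇒¬acb : First → ¬ Between a c b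
    first⇒¬acb first with first-orders first
    ... | BC-bc , _ = λ where
      (inj₁ (a<c , c<b)) → <-asym (proj₁ q-order a<c) (proj₂ BC-bc c<b)
      (inj₂ (c<a , b<c)) → <-asym (proj₂ q-order c<a) (proj₁ BC-bc b<c)

    first⇒¬BAC : First → Between b a c → ¬ Between B A C
    first⇒¬BAC first bac BAC with first-orders first | bac | BAC
    ... | _ , AC-ab | inj₁ (b<a , _) | inj₁ (_ , A<C) = <-asym A<C (proj₂ AC-ab b<a)
    ... | _ , _     | inj₁ (b<a , _) | inj₂ (A<B , _) = <-asym A<B (proj₂ p-order b<a)
    ... | _ , _     | inj₂ (a<b , _) | inj₁ (B<A , _) = <-asym B<A (proj₁ p-order a<b)
    ... | _ , AC-ab | inj₂ (a<b , _) | inj₂ (_ , C<A) = <-asym C<A (proj₁ AC-ab a<b)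

    second⇒BAC : Second → Between b a c → Between B A C
    second⇒BAC second bac with second-orders second | bac
    ... | AC-ac , BA-bc | inj₁ (b<a , a<c) = inj₁ (proj₁ BA-bc (<-trans b<a a<c) , proj₁ AC-ac a<c)
    ... | AC-ac , BA-bc | inj₂ (a<b , c<a) = inj₂ (proj₂ BA-bc (<-trans c<a a<b) , proj₂ AC-ac c<a)

    between-abc : Between a b c → First
    between-abc abc = first-unless λ second → second⇒¬abc second abc

    between-acb : Between a c b → Second
    between-acb acb = second-unless λ first → first⇒¬acb first acb

    between-bac : Between b a c → (Between B A C → Second) × (¬ Between B A C → First)
    between-bac bac = (λ BAC → second-unless λ first → first⇒¬BAC first bac BAC)
                    , (λ ¬BAC → first-unless λ second → ¬BAC (second⇒BAC second bac))

proposition3p6 :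
    ∀ (n : ℕ) (u x y v p q s t : Perm n) →
    BruhatEdge u p x → BruhatEdge x q v →
    BruhatEdge u s y → BruhatEdge y t v →
    ¬ (s ≈ p × y ≈ x × t ≈ q) →
    (Commute p q → s ≈ q × t ≈ p)
    × (∀ (a b c : Fin n) → a ≢ b → a ≢ c → b ≢ c →
         p ≈ transpose a b → q ≈ transpose a c →
         (Between a b c → s ≈ transpose b c × t ≈ transpose a b)
         × (Between a c b → s ≈ transpose a c × t ≈ transpose b c)
         × (Between b a c →
              (Between (u ⟨$⟩ˡ b) (u ⟨$⟩ˡ a) (u ⟨$⟩ˡ c) → s ≈ transpose a c × t ≈ transpose b c)
              × (¬ Between (u ⟨$⟩ˡ b) (u ⟨$⟩ˡ a) (u ⟨$⟩ˡ c) → s ≈ transpose b c × t ≈ transpose a b)))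
proposition3p6 n u x y v p q s t ux xv uy yv not-same =
  flip-commuting ,
  λ a b c a≢b a≢c b≢c p≈ab q≈ac →
    let open ThreeCycle a b c a≢b a≢c b≢c p≈ab q≈ac in between-abc , between-acb , between-bac
  where open Flip u x y v p q s t ux xv uy yv not-same
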